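{- Let $n\ge1$, let $G=P_n$ be the path with vertex set $\{1,\ldots,n\}$ and edges $\{i,i+1\}$ for $1\le i<n$, and let $C\subseteq\{1,\ldots,n\}$ be such that no vertex of $\{1,\ldots,n\}\setminus C$ is isolated in $G$. If $\{1,n\}\subseteq C$ or $C$ is a good configuration for $P_n$, then $\gamma_{\rm gr}(G;C)=m_1$; otherwise $\gamma_{\rm gr}(G;C)=m_1-1$.
   Context: For $v\in V(G)$, $N(v)$ is the open neighborhood, $N[v]=N(v)\cup\{v\}$, and $N\langle v\rangle=N[v]$ if $v\in C$, $N\langle v\rangle=N(v)$ otherwise. A sequence $(v_1,\ldots,v_k)$ of distinct vertices is legal if $N\langle v_i\rangle\setminus\bigcup_{j<i}N\langle v_j\rangle\ne\emptyset$ for $i=2,\ldots,k$, and dominating if $\bigcup_j N\langle v_j\rangle=V(G)$; $\gamma_{\rm gr}(G;C)$ is the maximum length of a legal dominating sequence. $m_1=n-\delta_1+1$ where $\delta_1=\min_{v\in V(G)}|N\langle v\rangle|$. Good configuration (gconf): for a path $Q$ whose vertices in path order are $u_1,\ldots,u_s$, a set $C$ is a gconf for $Q$ (meaning $C\cap V(Q)$ is considered; isolated vertices outside $C$ are allowed here) if (i) $s=1$ and $u_1\in C$; or (ii) $s=2$ and $\{u_1,u_2\}\not\subseteq C$; or (iii) $s\ge3$ and either $u_1\notin C$ and $C$ is a gconf for the subpath $u_3,\ldots,u_s$, or $u_s\notin C$ and $C$ is a gconf for the subpath $u_1,\ldots,u_{s-2}$. -}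

module Defs where

open import Data.Nat using (ℕ; zero; suc; _+_; _∸_; _≤_; _≡ᵇ_; _⊓_)
open import Data.Fin using (Fin; toℕ)
open import Data.Fin.Properties using () renaming (_≟_ to _≟ᶠ_)
open import Data.Bool using (Bool; true; false; _∧_; _∨_)
open import Data.List using (List; []; _∷_; _++_; length; map; filter; foldr; allFin)
open import Data.List.Membership.Propositional using (_∈_)
open import Data.List.Relation.Unary.Unique.Propositional using (Unique)
open import Data.Product using (Σ; ∃; _×_; _,_)
open import Data.Unit using (⊤)
open import Relation.Nullary using (¬_; does)
open import Relation.Binary.PropositionalEquality using (_≡_)

-- The path P_n on vertex set Fin n; Fin-vertex i stands for the paper's vertex (toℕ i + 1).
-- Adjacency: {i, i+1}.
adj : ∀ {n} → Fin n → Fin n → Bool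
adj i j = (suc (toℕ i) ≡ᵇ toℕ j) ∨ (suc (toℕ j) ≡ᵇ toℕ i)

Isolated : ∀ {n} → Fin n → Set
Isolated v = ∀ w → adj v w ≡ false

-- C ⊆ V(P_n) given by its characteristic function; v ∈ C iff C v ≡ true.
-- N⟨v⟩ : closed neighbourhood if v ∈ C, open neighbourhood otherwise.
inN : ∀ {n} → (Fin n → Bool) → Fin n → Fin n → Bool
inN C v w = (C v ∧ does (v ≟ᶠ w)) ∨ adj v w

InN : ∀ {n} → (Fin n → Bool) → Fin n → Fin n → Set
InN C v w = inN C v w ≡ true

cardN : ∀ {n} → (Fin n → Bool) → Fin n → ℕ
cardN {n} C v = length (filter (λ w → inN C v w ≟ᵇ true) (allFin n))
  where
  open import Data.Bool.Properties using () renaming (_≟_ to _≟ᵇ_)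

-- δ₁ = min_v |N⟨v⟩|  (the fold starts at n, which is ≥ every |N⟨v⟩|, so for n ≥ 1 this is the minimum)
δ₁ : ∀ {n} → (Fin n → Bool) → ℕ
δ₁ {n} C = foldr _⊓_ n (map (cardN C) (allFin n))

m₁ : ∀ {n} → (Fin n → Bool) → ℕ
m₁ {n} C = n ∸ δ₁ C + 1

LegalFrom : ∀ {n} → (Fin n → Bool) → List (Fin n) → List (Fin n) → Set
LegalFrom C prev [] = ⊤
LegalFrom C prev (x ∷ xs) =
  (∃ λ w → InN C x w × (∀ y → y ∈ prev → ¬ InN C y w)) × LegalFrom C (x ∷ prev) xs

Legal : ∀ {n} → (Fin n → Bool) → List (Fin n) → Set
Legal C [] = ⊤
Legal C (x ∷ xs) = LegalFrom C (x ∷ []) xs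

Dominating : ∀ {n} → (Fin n → Bool) → List (Fin n) → Set
Dominating {n} C s = ∀ (w : Fin n) → ∃ λ v → v ∈ s × InN C v w

LegalDominating : ∀ {n} → (Fin n → Bool) → List (Fin n) → Set
LegalDominating C s = Unique s × Legal C s × Dominating C s

GrundyIs : ∀ {n} → (Fin n → Bool) → ℕ → Set
GrundyIs {n} C m =
  (∃ λ (s : List (Fin n)) → LegalDominating C s × length s ≡ m)
  × (∀ (s : List (Fin n)) → LegalDominating C s → length s ≤ m)

-- Good configuration, stated on the list of C-memberships (b₁,…,b_s) of a path u₁,…,u_s
-- (b_i = true iff u_i ∈ C).
data Gconf : List Bool → Set where
  gc1 : Gconf (true ∷ [])
  gc2 : ∀ a b → ¬ (a ≡ true × b ≡ true) → Gconf (a ∷ b ∷ [])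
  gcL : ∀ b c cs → Gconf (c ∷ cs) → Gconf (false ∷ b ∷ c ∷ cs)
  gcR : ∀ x xs b → Gconf (x ∷ xs) → Gconf ((x ∷ xs) ++ (b ∷ false ∷ []))

pattern-of : ∀ {n} → (Fin n → Bool) → List Bool
pattern-of {n} C = map C (allFin n)

module Submission where

-- A legal sequence gives every vertex a footprint of its own, and its first vertex v₁ claims all of
-- N⟨v₁⟩, so it has at most n − |N⟨v₁⟩| + 1 ≤ m₁ vertices.  If an end of the path is not in C, then
-- δ₁ = 1 and m₁ = n, so γ = m₁ exactly when some legal sequence plays every vertex, and otherwise
-- playing 1, …, n − 1 in order gives γ = n − 1.  If both ends are in C, then δ₁ = 2 and this sequence
-- attains m₁ = n − 1.  A sequence playing every vertex exists iff C is a good configuration: an end u₁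
-- outside C has u₂ as its only footprint, so u₁, u₂ can be played around such a sequence for u₃, …, u_s,
-- and deleting them from a sequence for the whole path leaves one for u₃, …, u_s; when both ends are in
-- C the first vertex claims two footprints, leaving too few for the remaining vertices.

open import Defs
open import Data.Bool using (Bool; true; false; _∧_; _∨_; T)
open import Data.Bool.Properties using (T-≡; T-∧; T-∨; ∨-comm; ∨-zeroʳ; ¬-not) renaming (_≟_ to _≟ᵇ_)
open import Data.Empty using (⊥; ⊥-elim)
open import Data.Fin using (Fin; zero; suc; toℕ; fromℕ; fromℕ<)
open import Data.Fin.Properties
  using (toℕ<n; toℕ-fromℕ<; fromℕ<-toℕ; toℕ-fromℕ; toℕ-injective; ¬∀⟶∃¬) renaming (_≟_ to _≟ᶠ_)
open import Data.List using (List; []; _∷_; _++_; length; filter; map; reverse; allFin; tabulate; foldr)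
open import Data.List.Properties
  using (length-removeAt′; length-++; length-map; length-tabulate; map-++; map-tabulate; tabulate-cong;
         ∷-injective; ∷-injectiveˡ; ∷-injectiveʳ; reverse-++; reverse-injective)
open import Data.List.Membership.Propositional using (_∈_; _─_)
open import Data.List.Membership.Propositional.Properties
  using (∈-++⁺ˡ; ∈-++⁺ʳ; ∈-++⁻; ∈-filter⁺; ∈-filter⁻; ∈-map⁺; ∈-map⁻; ∈-allFin)
open import Data.List.Relation.Binary.Subset.Propositional using (_⊆_)
open import Data.List.Relation.Unary.All as All using (All)
open import Data.List.Relation.Unary.AllPairs using ([]; _∷_)
open import Data.List.Relation.Unary.Any using (here; there; index; any?)
open import Data.List.Relation.Unary.Unique.Propositional using (Unique)
import Data.List.Relation.Unary.Unique.Propositional.Properties as Unique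
open import Data.Nat using (ℕ; zero; suc; _+_; _∸_; _⊓_; _≤_; _<_; z≤n; s≤s; _≟_; _≤?_; _<?_; _≡ᵇ_)
open import Data.Nat.Properties
open import Data.Product using (Σ; ∃; _×_; _,_; proj₁; proj₂)
open import Data.Sum using (_⊎_; inj₁; inj₂; [_,_]; map₂)
open import Data.Unit using (⊤; tt)
open import Function using (id; _∘_; Equivalence)
open import Relation.Nullary using (¬_; Dec; yes; no; does)
open import Relation.Nullary.Decidable using (dec-true)
open import Relation.Unary using (Decidable)
open import Relation.Binary.PropositionalEquality hiding ([_])

open Equivalence using (to; from)

module _ {A : Set} where

  ∈-─⁺ : ∀ {x z : A} {ys} (x∈ys : x ∈ ys) → z ∈ ys → z ≢ x → z ∈ ys ─ x∈ys
  ∈-─⁺ (here refl) (here refl) z≢x = ⊥-elim (z≢x refl)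
  ∈-─⁺ (here _)    (there z∈ys) _  = z∈ys
  ∈-─⁺ (there _)   (here refl)  _  = here refl
  ∈-─⁺ (there x∈ys) (there z∈ys) z≢x = there (∈-─⁺ x∈ys z∈ys z≢x)

  Unique⇒length≤ : ∀ {xs ys : List A} → Unique xs → xs ⊆ ys → length xs ≤ length ys
  Unique⇒length≤ {[]}     _              _     = z≤n
  Unique⇒length≤ {x ∷ xs} {ys} (x∉xs ∷ xs!) xs⊆ys =
    ≤-trans (s≤s (Unique⇒length≤ xs! xs⊆ys─x)) (≤-reflexive (sym (length-removeAt′ ys (index x∈ys))))
    where
    x∈ys = xs⊆ys (here refl)
    xs⊆ys─x : xs ⊆ ys ─ x∈ys
    xs⊆ys─x z∈xs = ∈-─⁺ x∈ys (xs⊆ys (there z∈xs)) (λ z≡x → All.lookup x∉xs z∈xs (sym z≡x))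

++-pair-injective : ∀ {A : Set} (xs ys : List A) {p q r s}
                  → xs ++ p ∷ q ∷ [] ≡ ys ++ r ∷ s ∷ [] → xs ≡ ys × p ≡ r × q ≡ s
++-pair-injective xs ys {p} {q} {r} {s} eq with ∷-injective reversed
  where
  reversed : q ∷ p ∷ reverse xs ≡ s ∷ r ∷ reverse ys
  reversed = trans (sym (reverse-++ xs _)) (trans (cong reverse eq) (reverse-++ ys _))
... | q≡s , rest with ∷-injective rest
... | p≡r , rev≡ = reverse-injective rev≡ , p≡r , q≡s

length-allFin : ∀ n → length (allFin n) ≡ n
length-allFin n = length-tabulate (λ i → i)

∈-long-Unique : ∀ {n} {s : List (Fin n)} → Unique s → n ≤ length s → ∀ v → v ∈ s
∈-long-Unique {n} {s} s! n≤length v with any? (v ≟ᶠ_) s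
... | yes v∈s = v∈s
... | no  v∉s = ⊥-elim (<-irrefl refl (≤-trans longer n≤length))
  where
  v∷s! : Unique (v ∷ s)
  v∷s! = All.tabulate (λ v′∈s v≡v′ → v∉s (subst (_∈ s) (sym v≡v′) v′∈s)) ∷ s!
  longer : suc (length s) ≤ n
  longer = subst (suc (length s) ≤_) (length-allFin n) (Unique⇒length≤ v∷s! λ _ → ∈-allFin _)

fromℕ-list : ∀ {n} t → (∀ {y} → y ∈ t → y < n) → Σ (List (Fin n)) λ s → map toℕ s ≡ t
fromℕ-list []      _       = [] , refl
fromℕ-list (y ∷ t) t<n with fromℕ-list t (t<n ∘ there)
... | s , s≡t = fromℕ< (t<n (here refl)) ∷ s , cong₂ _∷_ (toℕ-fromℕ< _) s≡t

foldr-⊓-≤ : ∀ {A : Set} (f : A → ℕ) b {xs x} → x ∈ xs → foldr _⊓_ b (map f xs) ≤ f x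
foldr-⊓-≤ f b (here refl) = m⊓n≤m _ _
foldr-⊓-≤ f b (there x∈) = ≤-trans (m⊓n≤n _ _) (foldr-⊓-≤ f b x∈)

≤-foldr-⊓ : ∀ {A : Set} (f : A → ℕ) {b d} xs → d ≤ b → (∀ x → d ≤ f x) → d ≤ foldr _⊓_ b (map f xs)
≤-foldr-⊓ f []       d≤b _     = d≤b
≤-foldr-⊓ f (x ∷ xs) d≤b d≤f = ⊓-glb (d≤f x) (≤-foldr-⊓ f xs d≤b d≤f)

T-does⇒ : ∀ {A : Set} (a? : Dec A) → T (does a?) → A
T-does⇒ (yes a) _ = a

+-suc² : ∀ m a → m + suc (suc a) ≡ suc (suc (m + a))
+-suc² m a = trans (+-suc m (suc a)) (cong suc (+-suc m a))

false≢true : false ≢ true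
false≢true ()

not-both : ∀ {a b : Bool} → ¬ (a ≡ true × b ≡ true) → a ≡ false ⊎ b ≡ false
not-both {false}         _     = inj₁ refl
not-both {true} {false}  _     = inj₂ refl
not-both {true} {true}   ¬both = ⊥-elim (¬both (refl , refl))

module Legality {V : Set} (_▷_ : V → V → Set) where

  Footprint : (U P : V → Set) → V → V → Set
  Footprint U P x w = U w × x ▷ w × (∀ y → P y → ¬ y ▷ w)

  -- Footprints are confined to U, and P holds the vertices played before the sequence.
  LegalAfter : (U P : V → Set) → List V → Set
  LegalAfter U P []       = ⊤
  LegalAfter U P (x ∷ xs) = Σ V (Footprint U P x) × LegalAfter U (λ y → y ≡ x ⊎ P y) xs

  module _ {U : V → Set} where

    footprint-of : ∀ {P s z} → LegalAfter U P s → z ∈ s → Σ V (Footprint U P z)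
    footprint-of {s = x ∷ xs} (fp , _) (here refl) = fp
    footprint-of {s = x ∷ xs} (_ , ℓ) (there z∈xs) with footprint-of ℓ z∈xs
    ... | w , Uw , z▷w , fresh = w , Uw , z▷w , λ y Py → fresh y (inj₂ Py)

    footprints : ∀ {P} s → LegalAfter U P s → List V
    footprints []       _             = []
    footprints (x ∷ xs) ((w , _) , ℓ) = w ∷ footprints xs ℓ

    length-footprints : ∀ {P} s (ℓ : LegalAfter U P s) → length (footprints s ℓ) ≡ length s
    length-footprints []       _       = refl
    length-footprints (x ∷ xs) (_ , ℓ) = cong suc (length-footprints xs ℓ)

    footprints⊆U : ∀ {P} s (ℓ : LegalAfter U P s) {w} → w ∈ footprints s ℓ → U w
    footprints⊆U (x ∷ xs) ((w , Uw , _) , ℓ) (here refl) = Uw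
    footprints⊆U (x ∷ xs) (_ , ℓ)            (there w∈) = footprints⊆U xs ℓ w∈

    footprints-fresh : ∀ {P} s (ℓ : LegalAfter U P s) {w} → w ∈ footprints s ℓ → ∀ y → P y → ¬ y ▷ w
    footprints-fresh (x ∷ xs) ((w , _ , _ , fresh) , ℓ) (here refl) = fresh
    footprints-fresh (x ∷ xs) (_ , ℓ) (there w∈) y Py = footprints-fresh xs ℓ w∈ y (inj₂ Py)

    footprints-unique : ∀ {P} s (ℓ : LegalAfter U P s) → Unique (footprints s ℓ)
    footprints-unique []       _                         = []
    footprints-unique (x ∷ xs) ((w , _ , x▷w , _) , ℓ) =
      All.tabulate (λ w′∈ w≡w′ → footprints-fresh xs ℓ w′∈ x (inj₁ refl) (subst (x ▷_) w≡w′ x▷w))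
      ∷ footprints-unique xs ℓ

    LegalAfter⇒Unique : ∀ {P} s → LegalAfter U P s → Unique s
    LegalAfter⇒Unique []       _       = []
    LegalAfter⇒Unique (x ∷ xs) (_ , ℓ) = All.tabulate x∉xs ∷ LegalAfter⇒Unique xs ℓ
      where
      x∉xs : ∀ {y} → y ∈ xs → x ≢ y
      x∉xs y∈xs refl with footprint-of ℓ y∈xs
      ... | w , _ , x▷w , fresh = fresh x (inj₁ refl) x▷w

    -- The footprints F of an earlier vertex v and one footprint per vertex of xs are pairwise distinct.
    length+length≤ : ∀ {P v us} {F : List V} xs → LegalAfter U P xs → P v
                   → Unique F → (∀ {w} → w ∈ F → v ▷ w) → F ⊆ us → (∀ {w} → U w → w ∈ us)
                   → length F + length xs ≤ length us
    length+length≤ {P} {v} {us} {F} xs ℓ Pv F! v▷F F⊆us U⊆us = begin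
      length F + length xs                ≡⟨ cong (length F +_) (sym (length-footprints xs ℓ)) ⟩
      length F + length (footprints xs ℓ) ≡⟨ sym (length-++ F) ⟩
      length (F ++ footprints xs ℓ)       ≤⟨ Unique⇒length≤ F++fp! ⊆us ⟩
      length us                           ∎
      where
      open ≤-Reasoning
      F++fp! : Unique (F ++ footprints xs ℓ)
      F++fp! = Unique.++⁺ F! (footprints-unique xs ℓ)
                          λ (w∈F , w∈fp) → footprints-fresh xs ℓ w∈fp v Pv (v▷F w∈F)
      ⊆us : F ++ footprints xs ℓ ⊆ us
      ⊆us w∈ with ∈-++⁻ F w∈
      ... | inj₁ w∈F  = F⊆us w∈F
      ... | inj₂ w∈fp = U⊆us (footprints⊆U xs ℓ w∈fp)

  LegalAfter-weaken : ∀ {U U′ P Q} s → LegalAfter U P s → (∀ {w} → U w → U′ w)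
                    → (∀ y → Q y → P y ⊎ (∀ w → U w → ¬ y ▷ w)) → LegalAfter U′ Q s
  LegalAfter-weaken []       _                             _    _   = tt
  LegalAfter-weaken (x ∷ xs) ((w , Uw , x▷w , fresh) , ℓ) U⊆U′ Q⊆P =
    (w , U⊆U′ Uw , x▷w , λ y Qy → [ fresh y , (λ far → far w Uw) ] (Q⊆P y Qy)) ,
    LegalAfter-weaken xs ℓ U⊆U′ λ { y (inj₁ y≡x) → inj₁ (inj₁ y≡x)
                                  ; y (inj₂ Qy)  → [ inj₁ ∘ inj₂ , inj₂ ] (Q⊆P y Qy) }

  LegalAfter-++ : ∀ {U P Q} xs {ys} → LegalAfter U P xs → LegalAfter U Q ys
                → (∀ y → y ∈ xs ⊎ P y → Q y) → LegalAfter U P (xs ++ ys)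
  LegalAfter-++ []       _        ℓys Q⊇ = LegalAfter-weaken _ ℓys id (λ y Py → inj₁ (Q⊇ y (inj₂ Py)))
  LegalAfter-++ (x ∷ xs) (fp , ℓ) ℓys Q⊇ = fp , LegalAfter-++ xs ℓ ℓys λ
    { y (inj₁ y∈xs)        → Q⊇ y (inj₁ (there y∈xs))
    ; y (inj₂ (inj₁ refl)) → Q⊇ y (inj₁ (here refl))
    ; y (inj₂ (inj₂ Py))   → Q⊇ y (inj₂ Py) }

  -- Dropping vertices keeps a sequence legal as long as the footprints of the kept vertices stay
  -- in U′.  The one exception allowed, x₀ footprinting u, cannot happen: u is the only footprint
  -- of z, so whichever of x₀ and z comes second has no fresh footprint left.
  module _ {U U′ K : V → Set} (K? : Decidable K) {z u x₀ : V}
           (kept : ∀ {x w} → K x → U w → x ▷ w → U′ w ⊎ (x ≡ x₀ × w ≡ u))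
           (sole : ∀ {w} → U w → z ▷ w → w ≡ u) (z▷u : z ▷ u) (x₀▷u : x₀ ▷ u) (z≢x₀ : z ≢ x₀) where

    private
      x₀-not-u : ∀ {P : V → Set} xs → LegalAfter U (λ y → y ≡ x₀ ⊎ P y) xs → (∀ y → P y → ¬ y ▷ u)
               → ¬ (P z ⊎ z ∈ x₀ ∷ xs)
      x₀-not-u xs ℓ fresh (inj₁ Pz)               = fresh z Pz z▷u
      x₀-not-u xs ℓ fresh (inj₂ (here z≡x₀))      = z≢x₀ z≡x₀
      x₀-not-u xs ℓ fresh (inj₂ (there z∈xs)) with footprint-of ℓ z∈xs
      ... | w , Uw , z▷w , fresh′ with sole Uw z▷w
      ...   | refl = fresh′ x₀ (inj₁ refl) x₀▷u

      shift : ∀ {P : V → Set} {x xs} → P z ⊎ z ∈ x ∷ xs → (z ≡ x ⊎ P z) ⊎ z ∈ xs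
      shift (inj₁ Pz)          = inj₁ (inj₂ Pz)
      shift (inj₂ (here z≡x))  = inj₁ (inj₁ z≡x)
      shift (inj₂ (there z∈)) = inj₂ z∈

    LegalAfter-filter : ∀ {P Q : V → Set} s → LegalAfter U P s → (∀ y → Q y → P y) → P z ⊎ z ∈ s
                      → LegalAfter U′ Q (filter K? s)
    LegalAfter-filter []       _ _ _ = tt
    LegalAfter-filter {P} {Q} (x ∷ xs) ((w , Uw , x▷w , fresh) , ℓ) Q⊆P z∈ with K? x
    ... | no _   = LegalAfter-filter xs ℓ (λ y Qy → inj₂ (Q⊆P y Qy)) (shift {P} z∈)
    ... | yes Kx = footprint (kept Kx Uw x▷w)
                 , LegalAfter-filter xs ℓ (λ { y (inj₁ y≡x) → inj₁ y≡x ; y (inj₂ Qy) → inj₂ (Q⊆P y Qy) })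
                                     (shift {P} z∈)
      where
      footprint : U′ w ⊎ (x ≡ x₀ × w ≡ u) → Σ V (Footprint U′ Q x)
      footprint (inj₁ U′w)          = w , U′w , x▷w , λ y Qy → fresh y (Q⊆P y Qy)
      footprint (inj₂ (refl , refl)) = ⊥-elim (x₀-not-u xs ℓ fresh z∈)

-- The path on ℕ, with C given by c; x ▷ w says that w ∈ N⟨x⟩.
module Path (c : ℕ → Bool) where

  infix 4 _▷_
  _▷_ : ℕ → ℕ → Set
  x ▷ w = (c x ≡ true × x ≡ w) ⊎ (suc x ≡ w ⊎ suc w ≡ x)

  open Legality _▷_ public

  ▷-near : ∀ {x w} → x ▷ w → w ≤ suc x × x ≤ suc w
  ▷-near (inj₁ (_ , refl))  = n≤1+n _ , n≤1+n _
  ▷-near (inj₂ (inj₁ refl)) = ≤-refl , ≤-trans (n≤1+n _) (n≤1+n _)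
  ▷-near (inj₂ (inj₂ refl)) = ≤-trans (n≤1+n _) (n≤1+n _) , ≤-refl

  ▷-far : ∀ {x w} → 2 + x ≤ w ⊎ 2 + w ≤ x → ¬ x ▷ w
  ▷-far (inj₁ 2+x≤w) x▷w = <-irrefl refl (≤-trans 2+x≤w (proj₁ (▷-near x▷w)))
  ▷-far (inj₂ 2+w≤x) x▷w = <-irrefl refl (≤-trans 2+w≤x (proj₂ (▷-near x▷w)))

  ▷-self : ∀ {x} → x ▷ x → c x ≡ true
  ▷-self (inj₁ (cx , _))    = cx
  ▷-self (inj₂ (inj₁ 1+x≡x)) = ⊥-elim (1+n≢n 1+x≡x)
  ▷-self (inj₂ (inj₂ 1+x≡x)) = ⊥-elim (1+n≢n 1+x≡x)

  ¬▷-self : ∀ {x} → c x ≡ false → ¬ x ▷ x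
  ¬▷-self cx x▷x = false≢true (trans (sym cx) (▷-self x▷x))

  -- The segment [a, a + m), its bound written m + a so that it computes on m.
  Seg : ℕ → ℕ → ℕ → Set
  Seg a m w = a ≤ w × w < m + a

  <⇒Seg₀ : ∀ {m w} → w < m → Seg 0 m w
  <⇒Seg₀ {m} {w} w<m = z≤n , subst (w <_) (sym (+-identityʳ m)) w<m

  Seg₀⇒< : ∀ {m w} → Seg 0 m w → w < m
  Seg₀⇒< {m} {w} (_ , w<) = subst (w <_) (+-identityʳ m) w<

  segment : ℕ → ℕ → List ℕ
  segment a zero    = []
  segment a (suc m) = a ∷ segment (suc a) m

  Seg-first : ∀ {a m} → Seg a (suc m) a
  Seg-first {a} {m} = ≤-refl , s≤s (m≤n+m a m)

  Seg-second : ∀ {a m} → Seg a (2 + m) (suc a)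
  Seg-second {a} {m} = n≤1+n a , s≤s (s≤s (m≤n+m a m))

  Seg-penultimate : ∀ {a m} → Seg a (2 + m) (m + a)
  Seg-penultimate {a} {m} = m≤n+m a m , s≤s (n≤1+n _)

  Seg-last : ∀ {a m} → Seg a (2 + m) (suc (m + a))
  Seg-last {a} {m} = ≤-trans (m≤n+m a m) (n≤1+n _) , ≤-refl

  Seg-extendˡ : ∀ {a m w} → Seg (2 + a) m w → Seg a (2 + m) w
  Seg-extendˡ {a} {m} {w} (2+a≤w , w<) =
    ≤-trans (n≤1+n a) (≤-trans (n≤1+n _) 2+a≤w) , subst (w <_) (+-suc² m a) w<

  Seg-extendʳ : ∀ {a m w} → Seg a m w → Seg a (2 + m) w
  Seg-extendʳ (a≤w , w<) = a≤w , ≤-trans w< (≤-trans (n≤1+n _) (n≤1+n _))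

  Seg-splitˡ : ∀ {a m w} → Seg a (2 + m) w → w ≡ a ⊎ w ≡ suc a ⊎ Seg (2 + a) m w
  Seg-splitˡ {a} {m} {w} (a≤w , w<) with a ≟ w
  ... | yes refl = inj₁ refl
  ... | no a≢w with suc a ≟ w
  ...   | yes refl = inj₂ (inj₁ refl)
  ...   | no 1+a≢w =
    inj₂ (inj₂ (≤∧≢⇒< (≤∧≢⇒< a≤w a≢w) 1+a≢w , subst (w <_) (sym (+-suc² m a)) w<))

  Seg-splitʳ : ∀ {a m w} → Seg a (2 + m) w → Seg a m w ⊎ w ≡ m + a ⊎ w ≡ suc (m + a)
  Seg-splitʳ {a} {m} {w} (a≤w , w<) with w <? m + a
  ... | yes w<m+a = inj₁ (a≤w , w<m+a)
  ... | no w≮m+a with w ≟ m + a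
  ...   | yes w≡m+a = inj₂ (inj₁ w≡m+a)
  ...   | no w≢m+a = inj₂ (inj₂ (≤-antisym (≤-pred w<) (≤∧≢⇒< (≮⇒≥ w≮m+a) (w≢m+a ∘ sym))))

  Seg-single : ∀ {a w} → Seg a 1 w → w ≡ a
  Seg-single (a≤w , w<1+a) = ≤-antisym (≤-pred w<1+a) a≤w

  Seg-pair : ∀ {a w} → Seg a 2 w → w ≡ a ⊎ w ≡ suc a
  Seg-pair Sw with Seg-splitˡ {m = 0} Sw
  ... | inj₁ w≡a                  = inj₁ w≡a
  ... | inj₂ (inj₁ w≡1+a)         = inj₂ w≡1+a
  ... | inj₂ (inj₂ (2+a≤w , w<)) = ⊥-elim (<-irrefl refl (≤-trans w< 2+a≤w))

  ∈-segment⁻ : ∀ a m {w} → w ∈ segment a m → Seg a m w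
  ∈-segment⁻ a (suc m) (here refl) = Seg-first
  ∈-segment⁻ a (suc m) {w} (there w∈) with ∈-segment⁻ (suc a) m w∈
  ... | 1+a≤w , w< = ≤-trans (n≤1+n a) 1+a≤w , subst (w <_) (+-suc m a) w<

  ∈-segment⁺ : ∀ a m {w} → Seg a m w → w ∈ segment a m
  ∈-segment⁺ a zero    (a≤w , w<a) = ⊥-elim (<-irrefl refl (≤-trans w<a a≤w))
  ∈-segment⁺ a (suc m) {w} (a≤w , w<) with a ≟ w
  ... | yes refl = here refl
  ... | no a≢w   = there (∈-segment⁺ (suc a) m (≤∧≢⇒< a≤w a≢w , subst (w <_) (sym (+-suc m a)) w<))

  segment-unique : ∀ a m → Unique (segment a m)
  segment-unique a zero    = []
  segment-unique a (suc m) = All.tabulate (λ w∈ a≡w → <-irrefl a≡w (proj₁ (∈-segment⁻ (suc a) m w∈)))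
                             ∷ segment-unique (suc a) m

  length-segment : ∀ a m → length (segment a m) ≡ m
  length-segment a zero    = refl
  length-segment a (suc m) = cong suc (length-segment (suc a) m)

  segment-∷ʳ² : ∀ a m → segment a (2 + m) ≡ segment a m ++ m + a ∷ suc (m + a) ∷ []
  segment-∷ʳ² a zero    = refl
  segment-∷ʳ² a (suc m) = cong (a ∷_) (trans (segment-∷ʳ² (suc a) m)
                            (cong (λ e → segment (suc a) m ++ e ∷ suc e ∷ []) (+-suc m a)))

  map-segment : ∀ {A : Set} (f : ℕ → A) a m → map f (segment a m) ≡ tabulate (λ (i : Fin m) → f (toℕ i + a))
  map-segment f a zero    = refl
  map-segment f a (suc m) =
    cong (f a ∷_) (trans (map-segment f (suc a) m) (tabulate-cong λ i → cong f (+-suc (toℕ i) a)))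

  segment-legal : ∀ {a m} b j {P : ℕ → Set} → (∀ y → P y → y < b) → a ≤ b → suc (j + b) ≤ m + a
                → LegalAfter (Seg a m) P (segment b j)
  segment-legal b zero    _   _   _     = tt
  segment-legal {a} {m} b (suc j) P<b a≤b bound =
      (suc b , (≤-trans a≤b (n≤1+n b) , ≤-trans (s≤s (s≤s (m≤n+m b j))) bound) , inj₂ (inj₁ refl) ,
       λ y Py → ▷-far (inj₁ (s≤s (P<b y Py))))
    , segment-legal (suc b) j (λ { y (inj₁ refl) → ≤-refl ; y (inj₂ Py) → ≤-trans (P<b y Py) (n≤1+n b) })
                    (≤-trans a≤b (n≤1+n b)) (subst (λ x → suc x ≤ m + a) (sym (+-suc j b)) bound)

  segment-dominates : ∀ k → 0 < k ⊎ c 0 ≡ true → ∀ {w} → w < 2 + k → ∃ λ y → y ∈ segment 0 (suc k) × y ▷ w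
  segment-dominates k (inj₁ 0<k) {zero}  _           = 1 , ∈-segment⁺ 0 (suc k) (<⇒Seg₀ (s≤s 0<k)) , inj₂ (inj₂ refl)
  segment-dominates k (inj₂ c0)  {zero}  _           = 0 , here refl , inj₁ (c0 , refl)
  segment-dominates k _          {suc w} (s≤s w<1+k) = w , ∈-segment⁺ 0 (suc k) (<⇒Seg₀ w<1+k) , inj₂ (inj₁ refl)

  Full : ℕ → ℕ → List ℕ → Set
  Full a m s = LegalAfter (Seg a m) (λ _ → ⊥) s × (∀ {y} → y ∈ s → Seg a m y) × (∀ {y} → Seg a m y → y ∈ s)

  full-single : ∀ {a} → c a ≡ true → Full a 1 (a ∷ [])
  full-single ca = ((_ , Seg-first , inj₁ (ca , refl) , λ _ ()) , tt)
                 , (λ { (here refl) → Seg-first })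
                 , (λ Sy → here (Seg-single Sy))

  full-pair : ∀ {a x y} → c x ≡ false → x ▷ y → y ▷ x → (∀ {w} → Seg a 2 w → w ≡ x ⊎ w ≡ y)
            → Seg a 2 x → Seg a 2 y → Full a 2 (x ∷ y ∷ [])
  full-pair cx x▷y y▷x cover Sx Sy =
      ((_ , Sy , x▷y , λ _ ()) , (_ , Sx , y▷x , λ { _ (inj₁ refl) → ¬▷-self cx }) , tt)
    , (λ { (here refl) → Sx ; (there (here refl)) → Sy })
    , λ Sw → [ (λ { refl → here refl }) , (λ { refl → there (here refl) }) ] (cover Sw)

  full-consˡ : ∀ {a m t} → c a ≡ false → Full (2 + a) m t → Full a (2 + m) (a ∷ t ++ suc a ∷ [])
  full-consˡ {a} {m} {t} ca (ℓ , ∈Seg , ⊇Seg) = legal , members , cover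
    where
    a-far : ∀ w → Seg (2 + a) m w → ¬ a ▷ w
    a-far w (2+a≤w , _) = ▷-far (inj₁ 2+a≤w)

    last : ∀ y → y ∈ t ⊎ (y ≡ a ⊎ ⊥) → ¬ y ▷ a
    last y (inj₁ y∈t)          = ▷-far (inj₂ (proj₁ (∈Seg y∈t)))
    last y (inj₂ (inj₁ refl)) = ¬▷-self ca

    legal : LegalAfter (Seg a (2 + m)) (λ _ → ⊥) (a ∷ t ++ suc a ∷ [])
    legal = (suc a , Seg-second , inj₂ (inj₁ refl) , λ _ ())
          , LegalAfter-++ t (LegalAfter-weaken t ℓ Seg-extendˡ λ { y (inj₁ refl) → inj₂ a-far })
                          ((a , Seg-first , inj₂ (inj₂ refl) , last) , tt) (λ _ z → z)

    members : ∀ {y} → y ∈ a ∷ t ++ suc a ∷ [] → Seg a (2 + m) y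
    members (here refl) = Seg-first
    members (there y∈) with ∈-++⁻ t y∈
    ... | inj₁ y∈t          = Seg-extendˡ (∈Seg y∈t)
    ... | inj₂ (here refl) = Seg-second

    cover : ∀ {y} → Seg a (2 + m) y → y ∈ a ∷ t ++ suc a ∷ []
    cover Sy with Seg-splitˡ Sy
    ... | inj₁ refl          = here refl
    ... | inj₂ (inj₁ refl)   = there (∈-++⁺ʳ t (here refl))
    ... | inj₂ (inj₂ Sy′)    = there (∈-++⁺ˡ (⊇Seg Sy′))

  full-consʳ : ∀ {a m t} → c (suc (m + a)) ≡ false → Full a m t
             → Full a (2 + m) (suc (m + a) ∷ t ++ m + a ∷ [])
  full-consʳ {a} {m} {t} ce (ℓ , ∈Seg , ⊇Seg) = legal , members , cover
    where
    e-far : ∀ w → Seg a m w → ¬ suc (m + a) ▷ w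
    e-far w (_ , w<) = ▷-far (inj₂ (s≤s w<))

    last : ∀ y → y ∈ t ⊎ (y ≡ suc (m + a) ⊎ ⊥) → ¬ y ▷ suc (m + a)
    last y (inj₁ y∈t)          = ▷-far (inj₁ (s≤s (proj₂ (∈Seg y∈t))))
    last y (inj₂ (inj₁ refl)) = ¬▷-self ce

    legal : LegalAfter (Seg a (2 + m)) (λ _ → ⊥) (suc (m + a) ∷ t ++ m + a ∷ [])
    legal = (m + a , Seg-penultimate , inj₂ (inj₂ refl) , λ _ ())
          , LegalAfter-++ t (LegalAfter-weaken t ℓ Seg-extendʳ λ { y (inj₁ refl) → inj₂ e-far })
                          ((suc (m + a) , Seg-last , inj₂ (inj₁ refl) , last) , tt) (λ _ z → z)

    members : ∀ {y} → y ∈ suc (m + a) ∷ t ++ m + a ∷ [] → Seg a (2 + m) y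
    members (here refl) = Seg-last
    members (there y∈) with ∈-++⁻ t y∈
    ... | inj₁ y∈t          = Seg-extendʳ (∈Seg y∈t)
    ... | inj₂ (here refl) = Seg-penultimate

    cover : ∀ {y} → Seg a (2 + m) y → y ∈ suc (m + a) ∷ t ++ m + a ∷ []
    cover Sy with Seg-splitʳ Sy
    ... | inj₁ Sy′          = there (∈-++⁺ˡ (⊇Seg Sy′))
    ... | inj₂ (inj₁ refl)  = there (∈-++⁺ʳ t (here refl))
    ... | inj₂ (inj₂ refl)  = here refl

  gconf⇒full : ∀ {l} → Gconf l → ∀ a m → l ≡ map c (segment a m) → Σ (List ℕ) (Full a m)
  gconf⇒full gc1 a 1 eq = _ , full-single (sym (∷-injectiveˡ eq))
  gconf⇒full (gc2 _ _ ¬both) a 2 eq with c a in ca | c (suc a) in c1+a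
  ... | false | _     = _ , full-pair ca (inj₂ (inj₁ refl)) (inj₂ (inj₂ refl)) Seg-pair Seg-first Seg-second
  ... | true  | false =
    _ , full-pair c1+a (inj₂ (inj₂ refl)) (inj₂ (inj₁ refl)) ([ inj₂ , inj₁ ] ∘ Seg-pair) Seg-second Seg-first
  ... | true  | true with ∷-injective eq
  ...   | refl , refl = ⊥-elim (¬both (refl , refl))
  gconf⇒full (gcL _ _ _ g) a (suc (suc (suc m))) eq
    with gconf⇒full g (2 + a) (suc m) (∷-injectiveʳ (∷-injectiveʳ eq))
  ... | _ , full = _ , full-consˡ (sym (∷-injectiveˡ eq)) full
  gconf⇒full (gcR _ []      _ _) a 1 ()
  gconf⇒full (gcR _ (_ ∷ _) _ _) a 1 ()
  gconf⇒full (gcR x xs _ g) a (suc (suc m)) eq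
    with ++-pair-injective (x ∷ xs) _ (trans eq (trans (cong (map c) (segment-∷ʳ² a m)) (map-++ c (segment a m) _)))
  gconf⇒full (gcR _ _ _ g) a (suc (suc zero))    eq | () , _
  gconf⇒full (gcR _ _ _ g) a (suc (suc (suc m))) eq | init , _ , 1+m+a∉C with gconf⇒full g a (suc m) init
  ... | _ , full = _ , full-consʳ (sym 1+m+a∉C) full

  peelˡ : ∀ {a m s} → c a ≡ false → Full a (2 + m) s → Full (2 + a) m (filter (2 + a ≤?_) s)
  peelˡ {a} {m} {s} ca (ℓ , ∈Seg , ⊇Seg) =
      LegalAfter-filter (2 + a ≤?_) kept sole (inj₂ (inj₁ refl)) (inj₂ (inj₂ refl))
                        (λ a≡2+a → <-irrefl a≡2+a (s≤s (n≤1+n a))) s ℓ (λ _ ()) (inj₂ (⊇Seg Seg-first))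
    , members , cover
    where
    kept : ∀ {x w} → 2 + a ≤ x → Seg a (2 + m) w → x ▷ w → Seg (2 + a) m w ⊎ (x ≡ 2 + a × w ≡ suc a)
    kept 2+a≤x Sw x▷w with Seg-splitˡ Sw
    ... | inj₁ refl          = ⊥-elim (▷-far (inj₂ 2+a≤x) x▷w)
    ... | inj₂ (inj₁ refl)   = inj₂ (≤-antisym (proj₂ (▷-near x▷w)) 2+a≤x , refl)
    ... | inj₂ (inj₂ Sw′)    = inj₁ Sw′

    sole : ∀ {w} → Seg a (2 + m) w → a ▷ w → w ≡ suc a
    sole _          (inj₁ (ca′ , _))   = ⊥-elim (false≢true (trans (sym ca) ca′))
    sole _          (inj₂ (inj₁ refl)) = refl
    sole (a≤w , _)  (inj₂ (inj₂ refl)) = ⊥-elim (<-irrefl refl a≤w)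

    members : ∀ {y} → y ∈ filter (2 + a ≤?_) s → Seg (2 + a) m y
    members {y} y∈ with ∈-filter⁻ (2 + a ≤?_) y∈
    ... | y∈s , 2+a≤y = 2+a≤y , subst (y <_) (sym (+-suc² m a)) (proj₂ (∈Seg y∈s))

    cover : ∀ {y} → Seg (2 + a) m y → y ∈ filter (2 + a ≤?_) s
    cover Sy = ∈-filter⁺ (2 + a ≤?_) (⊇Seg (Seg-extendˡ Sy)) (proj₁ Sy)

  peelʳ : ∀ {a m s} → c (2 + m + a) ≡ false → Full a (3 + m) s → Full a (1 + m) (filter (_<? 1 + m + a) s)
  peelʳ {a} {m} {s} ce (ℓ , ∈Seg , ⊇Seg) =
      LegalAfter-filter (_<? 1 + m + a) kept sole (inj₂ (inj₂ refl)) (inj₂ (inj₁ refl))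
                        (λ eq → <-irrefl (sym eq) (n≤1+n _)) s ℓ (λ _ ()) (inj₂ (⊇Seg Seg-last))
    , members , cover
    where
    kept : ∀ {x w} → x < 1 + m + a → Seg a (3 + m) w → x ▷ w
         → Seg a (1 + m) w ⊎ (x ≡ m + a × w ≡ 1 + m + a)
    kept x<1+m+a Sw x▷w with Seg-splitʳ Sw
    ... | inj₁ Sw′          = inj₁ Sw′
    ... | inj₂ (inj₁ refl)  = inj₂ (≤-antisym (≤-pred x<1+m+a) (≤-pred (proj₁ (▷-near x▷w))) , refl)
    ... | inj₂ (inj₂ refl)  = ⊥-elim (▷-far (inj₁ (s≤s x<1+m+a)) x▷w)

    sole : ∀ {w} → Seg a (3 + m) w → 2 + m + a ▷ w → w ≡ 1 + m + a
    sole _         (inj₁ (ce′ , _))   = ⊥-elim (false≢true (trans (sym ce) ce′))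
    sole (_ , w<)  (inj₂ (inj₁ refl)) = ⊥-elim (<-irrefl refl w<)
    sole _         (inj₂ (inj₂ eq))   = suc-injective eq

    members : ∀ {y} → y ∈ filter (_<? 1 + m + a) s → Seg a (1 + m) y
    members y∈ with ∈-filter⁻ (_<? 1 + m + a) {xs = s} y∈
    ... | y∈s , y<1+m+a = proj₁ (∈Seg y∈s) , y<1+m+a

    cover : ∀ {y} → Seg a (1 + m) y → y ∈ filter (_<? 1 + m + a) s
    cover Sy = ∈-filter⁺ (_<? 1 + m + a) (⊇Seg (Seg-extendʳ Sy)) (proj₂ Sy)

  two-footprints : ∀ {a m v} → c a ≡ true → c (suc (m + a)) ≡ true → Seg a (2 + m) v
                 → ∃ λ u₁ → ∃ λ u₂ → u₁ ≢ u₂ × (Seg a (2 + m) u₁ × v ▷ u₁) × (Seg a (2 + m) u₂ × v ▷ u₂)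
  two-footprints {a} {m} {v} ca ce (a≤v , v<) with v ≟ a | v ≟ suc (m + a)
  ... | yes refl | _        = _ , _ , 1+n≢n ∘ sym , (Seg-first , inj₁ (ca , refl)) , (Seg-second , inj₂ (inj₁ refl))
  ... | no _     | yes refl =
    _ , _ , 1+n≢n ∘ sym , (Seg-penultimate , inj₂ (inj₂ refl)) , (Seg-last , inj₁ (ce , refl))
  two-footprints {a} {m} {zero} ca ce (z≤n , _) | no 0≢a | no _ = ⊥-elim (0≢a refl)
  two-footprints {a} {m} {suc v} ca ce (a≤1+v , 1+v<) | no 1+v≢a | no 1+v≢e =
    _ , _ , (λ eq → <-irrefl eq (n≤1+n (suc v))) ,
    ((≤-pred (≤∧≢⇒< a≤1+v (1+v≢a ∘ sym)) , ≤-trans (n≤1+n _) 1+v<) , inj₂ (inj₂ refl)) ,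
    ((≤-trans a≤1+v (n≤1+n _) , s≤s (≤∧≢⇒< (≤-pred 1+v<) 1+v≢e)) , inj₂ (inj₁ refl))

  ¬full-both-ends : ∀ {a m s} → c a ≡ true → c (suc (m + a)) ≡ true → ¬ Full a (2 + m) s
  ¬full-both-ends {s = []} _ _ (_ , _ , ⊇Seg) with ⊇Seg Seg-first
  ... | ()
  ¬full-both-ends {a} {m} {v ∷ xs} ca ce ((_ , ℓ) , ∈Seg , ⊇Seg)
    with two-footprints ca ce (∈Seg (here refl))
  ... | u₁ , u₂ , u₁≢u₂ , (Su₁ , v▷u₁) , (Su₂ , v▷u₂) = <-irrefl refl (≤-trans at-most at-least)
    where
    at-most : 2 + length xs ≤ 2 + m
    at-most = subst (2 + length xs ≤_) (length-segment a (2 + m))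
      (length+length≤ {F = u₁ ∷ u₂ ∷ []} xs ℓ (inj₁ refl) ((u₁≢u₂ All.∷ All.[]) ∷ All.[] ∷ [])
        (λ { (here refl) → v▷u₁ ; (there (here refl)) → v▷u₂ })
        (λ { (here refl) → ∈-segment⁺ a (2 + m) Su₁ ; (there (here refl)) → ∈-segment⁺ a (2 + m) Su₂ })
        (∈-segment⁺ a (2 + m)))
    at-least : 2 + m ≤ 1 + length xs
    at-least = subst (_≤ 1 + length xs) (length-segment a (2 + m))
      (Unique⇒length≤ (segment-unique a (2 + m)) (⊇Seg ∘ ∈-segment⁻ a (2 + m)))

  full⇒gconf : ∀ m a s → Full a (suc m) s → Gconf (map c (segment a (suc m)))
  full⇒gconf zero a s (ℓ , _ , ⊇Seg) with footprint-of ℓ (⊇Seg Seg-first)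
  ... | w , Sw , a▷w , _ with Seg-single Sw
  ... | refl = subst (λ b → Gconf (b ∷ [])) (sym (▷-self a▷w)) gc1
  full⇒gconf (suc zero) a s full = gc2 _ _ λ (ca , c1+a) → ¬full-both-ends ca c1+a full
  full⇒gconf (suc (suc m)) a s full with c (suc (suc (m + a))) in ce
  ... | false = subst Gconf (sym layout) (gcR _ _ _ (full⇒gconf m a _ (peelʳ ce full)))
    where
    layout : map c (segment a (3 + m)) ≡ map c (segment a (suc m)) ++ c (suc m + a) ∷ false ∷ []
    layout = trans (cong (map c) (segment-∷ʳ² a (suc m))) (trans (map-++ c (segment a (suc m)) _)
                   (cong (λ b → map c (segment a (suc m)) ++ c (suc m + a) ∷ b ∷ []) ce))
  ... | true with c a in ca
  ...   | false = gcL _ _ _ (full⇒gconf m (2 + a) _ (peelˡ ca full))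
  ...   | true  = ⊥-elim (¬full-both-ends ca ce full)

adj-sym : ∀ {n} (v w : Fin n) → adj v w ≡ adj w v
adj-sym v w = ∨-comm (suc (toℕ v) ≡ᵇ toℕ w) _

-- P_n is the segment [0, n) of the path ℕ, and C is extended by false beyond it.
module Embedding {n : ℕ} (C : Fin n → Bool) where

  c : ℕ → Bool
  c i with i <? n
  ... | yes i<n = C (fromℕ< i<n)
  ... | no _    = false

  c-toℕ : ∀ v → c (toℕ v) ≡ C v
  c-toℕ v with toℕ v <? n
  ... | yes v<n = cong C (fromℕ<-toℕ v v<n)
  ... | no v≮n  = ⊥-elim (v≮n (toℕ<n v))

  open Path c public

  adj⇒InN : ∀ {v w} → adj v w ≡ true → InN C v w
  adj⇒InN {v} {w} v~w = trans (cong (C v ∧ does (v ≟ᶠ w) ∨_) v~w) (∨-zeroʳ _)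

  InN⇒▷ : ∀ {v w} → InN C v w → toℕ v ▷ toℕ w
  InN⇒▷ {v} {w} v→w with to T-∨ (from T-≡ v→w)
  ... | inj₁ v∈C∧v≡w with to T-∧ v∈C∧v≡w
  ...   | v∈C , v≡w = inj₁ (trans (c-toℕ v) (to T-≡ v∈C) , cong toℕ (T-does⇒ (v ≟ᶠ w) v≡w))
  InN⇒▷ {v} {w} v→w | inj₂ v~w with to T-∨ v~w
  ...   | inj₁ 1+v≡w = inj₂ (inj₁ (≡ᵇ⇒≡ _ _ 1+v≡w))
  ...   | inj₂ 1+w≡v = inj₂ (inj₂ (≡ᵇ⇒≡ _ _ 1+w≡v))

  ▷⇒InN : ∀ {v w} → toℕ v ▷ toℕ w → InN C v w
  ▷⇒InN {v} {w} (inj₁ (cv , v≡w)) with toℕ-injective v≡w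
  ... | refl =
    to T-≡ (from T-∨ (inj₁ (from T-∧ (from T-≡ (trans (sym (c-toℕ v)) cv) , from T-≡ (dec-true (v ≟ᶠ v) refl)))))
  ▷⇒InN (inj₂ (inj₁ 1+v≡w)) = adj⇒InN (to T-≡ (from T-∨ (inj₁ (≡⇒≡ᵇ _ _ 1+v≡w))))
  ▷⇒InN (inj₂ (inj₂ 1+w≡v)) = adj⇒InN (to T-≡ (from T-∨ (inj₂ (≡⇒≡ᵇ _ _ 1+w≡v))))

  Seg-toℕ : ∀ v → Seg 0 n (toℕ v)
  Seg-toℕ v = <⇒Seg₀ (toℕ<n v)

  pattern-of≡ : pattern-of C ≡ map c (segment 0 n)
  pattern-of≡ = begin
    map C (allFin n)                  ≡⟨ map-tabulate (λ i → i) C ⟩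
    tabulate C                        ≡⟨ tabulate-cong (λ i → trans (sym (c-toℕ i)) (cong c (sym (+-identityʳ _)))) ⟩
    tabulate (λ i → c (toℕ i + 0))    ≡⟨ sym (map-segment c 0 n) ⟩
    map c (segment 0 n)               ∎
    where open ≡-Reasoning

  toℕ-legal : ∀ {P : ℕ → Set} prev xs → LegalFrom C prev xs → (∀ y → P y → ∃ λ v → v ∈ prev × toℕ v ≡ y)
            → LegalAfter (Seg 0 n) P (map toℕ xs)
  toℕ-legal prev []       _                      _       = tt
  toℕ-legal {P} prev (x ∷ xs) ((w , x→w , fresh) , ℓ) P⊆prev =
    (toℕ w , Seg-toℕ w , InN⇒▷ x→w , fresh′) , toℕ-legal (x ∷ prev) xs ℓ P′⊆prev
    where
    fresh′ : ∀ y → P y → ¬ y ▷ toℕ w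
    fresh′ y Py y▷w with P⊆prev y Py
    ... | v , v∈prev , refl = fresh v v∈prev (▷⇒InN y▷w)
    P′⊆prev : ∀ y → y ≡ toℕ x ⊎ P y → ∃ λ v → v ∈ x ∷ prev × toℕ v ≡ y
    P′⊆prev y (inj₁ refl) = x , here refl , refl
    P′⊆prev y (inj₂ Py) with P⊆prev y Py
    ... | v , v∈prev , v≡y = v , there v∈prev , v≡y

  fromℕ-legal : ∀ {P : ℕ → Set} prev xs → LegalAfter (Seg 0 n) P (map toℕ xs) → (∀ v → v ∈ prev → P (toℕ v))
              → LegalFrom C prev xs
  fromℕ-legal prev []       _ _ = tt
  fromℕ-legal {P} prev (x ∷ xs) ((w , Sw , x▷w , fresh) , ℓ) prev⊆P =
    (fromℕ< (Seg₀⇒< Sw) , ▷⇒InN (subst (toℕ x ▷_) w≡ x▷w) , fresh′) ,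
    fromℕ-legal (x ∷ prev) xs ℓ λ { v (here refl) → inj₁ refl ; v (there v∈prev) → inj₂ (prev⊆P v v∈prev) }
    where
    w≡ : w ≡ toℕ (fromℕ< (Seg₀⇒< Sw))
    w≡ = sym (toℕ-fromℕ< (Seg₀⇒< Sw))
    fresh′ : ∀ y → y ∈ prev → ¬ InN C y (fromℕ< (Seg₀⇒< Sw))
    fresh′ y y∈prev y→w = fresh (toℕ y) (prev⊆P y y∈prev) (subst (toℕ y ▷_) (sym w≡) (InN⇒▷ y→w))

  legalℕ⇒Legal : ∀ s → LegalAfter (Seg 0 n) (λ _ → ⊥) (map toℕ s) → Legal C s
  legalℕ⇒Legal []       _       = tt
  legalℕ⇒Legal (x ∷ xs) (_ , ℓ) = fromℕ-legal (x ∷ []) xs ℓ λ { v (here refl) → inj₁ refl }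

  Legal⇒legalℕ : ∀ s → Legal C s → (∀ v → ∃ (InN C v)) → LegalAfter (Seg 0 n) (λ _ → ⊥) (map toℕ s)
  Legal⇒legalℕ []       _ _         = tt
  Legal⇒legalℕ (x ∷ xs) ℓ footprint with footprint x
  ... | w , x→w = (toℕ w , Seg-toℕ w , InN⇒▷ x→w , λ _ ()) ,
                  toℕ-legal (x ∷ []) xs ℓ λ { y (inj₁ refl) → x , here refl , refl }

  N⟨_⟩ : Fin n → List ℕ
  N⟨ v ⟩ = map toℕ (filter (λ w → inN C v w ≟ᵇ true) (allFin n))

  ∈-N⟨⟩⁻ : ∀ {v u} → u ∈ N⟨ v ⟩ → Seg 0 n u × toℕ v ▷ u
  ∈-N⟨⟩⁻ {v} u∈ with ∈-map⁻ toℕ u∈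
  ... | w , w∈ , refl = Seg-toℕ w , InN⇒▷ (proj₂ (∈-filter⁻ (λ w → inN C v w ≟ᵇ true) {xs = allFin n} w∈))

  ∈-N⟨⟩⁺ : ∀ {v u} → Seg 0 n u → toℕ v ▷ u → u ∈ N⟨ v ⟩
  ∈-N⟨⟩⁺ {v} Su v▷u = subst (_∈ N⟨ v ⟩) u≡ (∈-map⁺ toℕ (∈-filter⁺ (λ w → inN C v w ≟ᵇ true) (∈-allFin _) v→u))
    where
    u≡ = toℕ-fromℕ< (Seg₀⇒< Su)
    v→u = ▷⇒InN (subst (toℕ v ▷_) (sym u≡) v▷u)

  N⟨⟩-unique : ∀ v → Unique N⟨ v ⟩
  N⟨⟩-unique v = Unique.map⁺ toℕ-injective (Unique.filter⁺ (λ w → inN C v w ≟ᵇ true) (Unique.allFin⁺ n))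

  length-N⟨⟩ : ∀ v → length N⟨ v ⟩ ≡ cardN C v
  length-N⟨⟩ v = length-map toℕ (filter (λ w → inN C v w ≟ᵇ true) (allFin n))

  cardN-≥ : ∀ {v F} → Unique F → (∀ {u} → u ∈ F → Seg 0 n u × toℕ v ▷ u) → length F ≤ cardN C v
  cardN-≥ {v} F! F⊆N =
    subst (_ ≤_) (length-N⟨⟩ v)
          (Unique⇒length≤ F! λ u∈ → ∈-N⟨⟩⁺ (proj₁ (F⊆N u∈)) (proj₂ (F⊆N u∈)))

  cardN-≤ : ∀ {v F} → (∀ {u} → Seg 0 n u → toℕ v ▷ u → u ∈ F) → cardN C v ≤ length F
  cardN-≤ {v} N⊆F =
    subst (_≤ _) (length-N⟨⟩ v)
          (Unique⇒length≤ (N⟨⟩-unique v) λ u∈ → N⊆F (proj₁ (∈-N⟨⟩⁻ u∈)) (proj₂ (∈-N⟨⟩⁻ u∈)))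

  δ₁≤cardN : ∀ v → δ₁ C ≤ cardN C v
  δ₁≤cardN v = foldr-⊓-≤ (cardN C) n (∈-allFin v)

  ≤δ₁ : ∀ {d} → d ≤ n → (∀ v → d ≤ cardN C v) → d ≤ δ₁ C
  ≤δ₁ d≤n d≤cardN = ≤-foldr-⊓ (cardN C) (allFin n) d≤n d≤cardN

  m₁≤ : ∀ {d} → d ≤ δ₁ C → m₁ C ≤ n ∸ d + 1
  m₁≤ {d} d≤δ₁ = +-monoˡ-≤ 1 (∸-monoʳ-≤ n d≤δ₁)

  length≤m₁ : ∀ s → Legal C s → length s ≤ m₁ C
  length≤m₁ []       _ = z≤n
  length≤m₁ (v ∷ xs) ℓ = begin
    suc (length xs)    ≡⟨ +-comm 1 (length xs) ⟩
    length xs + 1      ≤⟨ +-monoˡ-≤ 1 (m+n≤o⇒m≤o∸n (length xs) (subst (_≤ n) (+-comm (cardN C v) _) counted)) ⟩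
    n ∸ cardN C v + 1  ≤⟨ +-monoˡ-≤ 1 (∸-monoʳ-≤ n (δ₁≤cardN v)) ⟩
    m₁ C               ∎
    where
    open ≤-Reasoning
    ℓℕ : LegalAfter (Seg 0 n) (_≡ toℕ v) (map toℕ xs)
    ℓℕ = toℕ-legal (v ∷ []) xs ℓ λ { y refl → v , here refl , refl }
    counted : cardN C v + length xs ≤ n
    counted = subst₂ _≤_ (cong₂ _+_ (length-N⟨⟩ v) (length-map toℕ xs)) (length-segment 0 n)
      (length+length≤ (map toℕ xs) ℓℕ refl
        (N⟨⟩-unique v) (proj₂ ∘ ∈-N⟨⟩⁻) (∈-segment⁺ 0 n ∘ proj₁ ∘ ∈-N⟨⟩⁻) (∈-segment⁺ 0 n))

  attains-m₁ : ∀ {s} → LegalDominating C s → m₁ C ≤ length s → GrundyIs C (m₁ C)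
  attains-m₁ {s} ld@(_ , ℓ , _) m₁≤length =
    (s , ld , ≤-antisym (length≤m₁ s ℓ) m₁≤length) , λ t (_ , ℓt , _) → length≤m₁ t ℓt

  1≤cardN : ∀ {v w} → InN C v w → 1 ≤ cardN C v
  1≤cardN {w = w} v→w = cardN-≥ (All.[] ∷ []) λ { (here refl) → Seg-toℕ w , InN⇒▷ v→w }

  InN-self : ∀ {v} → C v ≡ true → InN C v v
  InN-self {v} Cv = ▷⇒InN (inj₁ (trans (c-toℕ v) Cv , refl))

  module _ (no-isolated : ∀ v → C v ≡ false → ¬ Isolated v) where

    in-C-or-adjacent : ∀ v → C v ≡ true ⊎ ∃ λ u → adj v u ≡ true
    in-C-or-adjacent v with C v in Cv
    ... | true  = inj₁ refl
    ... | false with ¬∀⟶∃¬ n (λ u → adj v u ≡ false) (λ u → adj v u ≟ᵇ false) (no-isolated v Cv)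
    ...   | u , v≁u = inj₂ (u , ¬-not v≁u)

    has-footprint : ∀ v → ∃ (InN C v)
    has-footprint v = [ (λ Cv → v , InN-self Cv) , (λ (u , v~u) → u , adj⇒InN v~u) ] (in-C-or-adjacent v)

    is-footprint : ∀ w → ∃ λ v → InN C v w
    is-footprint w =
      [ (λ Cw → w , InN-self Cw) , (λ (u , w~u) → u , adj⇒InN (trans (adj-sym u w) w~u)) ] (in-C-or-adjacent w)

    m₁≤n : 1 ≤ n → m₁ C ≤ n
    m₁≤n 1≤n = ≤-trans (m₁≤ (≤δ₁ 1≤n λ v → 1≤cardN (proj₂ (has-footprint v)))) (≤-reflexive (m∸n+n≡m 1≤n))

    full⇒spanning : ∀ {t} → Full 0 n t → Σ (List (Fin n)) λ s → LegalDominating C s × n ≤ length s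
    full⇒spanning {t} (ℓ , ∈Seg , ⊇Seg) with fromℕ-list t (Seg₀⇒< ∘ ∈Seg)
    ... | s , refl = s , (s! , legalℕ⇒Legal s ℓ , dominating) , n≤length
      where
      s! : Unique s
      s! = Unique.map⁻ (LegalAfter⇒Unique (map toℕ s) ℓ)
      every : ∀ v → v ∈ s
      every v with ∈-map⁻ toℕ (⊇Seg (Seg-toℕ v))
      ... | v′ , v′∈s , v≡v′ = subst (_∈ s) (sym (toℕ-injective v≡v′)) v′∈s
      dominating : Dominating C s
      dominating w with is-footprint w
      ... | v , v→w = v , every v , v→w
      n≤length : n ≤ length s
      n≤length = subst (_≤ length s) (length-allFin n) (Unique⇒length≤ (Unique.allFin⁺ n) λ {v} _ → every v)

    spanning⇒full : ∀ s → Legal C s → Unique s → n ≤ length s → Full 0 n (map toℕ s)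
    spanning⇒full s ℓ s! n≤length = Legal⇒legalℕ s ℓ has-footprint , members , cover
      where
      members : ∀ {y} → y ∈ map toℕ s → Seg 0 n y
      members y∈ with ∈-map⁻ toℕ y∈
      ... | v , _ , refl = Seg-toℕ v
      cover : ∀ {y} → Seg 0 n y → y ∈ map toℕ s
      cover Sy = subst (_∈ map toℕ s) (toℕ-fromℕ< (Seg₀⇒< Sy)) (∈-map⁺ toℕ (∈-long-Unique s! n≤length _))

    gconf⇒GrundyIs : 1 ≤ n → Gconf (pattern-of C) → GrundyIs C (m₁ C)
    gconf⇒GrundyIs 1≤n g with gconf⇒full g 0 n pattern-of≡
    ... | _ , full with full⇒spanning full
    ... | _ , ld , n≤length = attains-m₁ ld (≤-trans (m₁≤n 1≤n) n≤length)

module _ (k : ℕ) (C : Fin (2 + k) → Bool) where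
  open Embedding C

  prefix-sequence : 0 < k ⊎ C zero ≡ true → ∃ λ s → LegalDominating C s × length s ≡ suc k
  prefix-sequence h with fromℕ-list (segment 0 (suc k)) below-n
    where
    below-n : ∀ {y} → y ∈ segment 0 (suc k) → y < 2 + k
    below-n y∈ = m<n⇒m<1+n (Seg₀⇒< (∈-segment⁻ 0 (suc k) y∈))
  ... | s , s≡t = s , (Unique.map⁻ (LegalAfter⇒Unique _ ℓ) , legalℕ⇒Legal s ℓ , dominating) ,
                  trans (sym (length-map toℕ s)) (trans (cong length s≡t) (length-segment 0 (suc k)))
    where
    ℓ : LegalAfter (Seg 0 (2 + k)) (λ _ → ⊥) (map toℕ s)
    ℓ = subst (LegalAfter (Seg 0 (2 + k)) (λ _ → ⊥)) (sym s≡t) (segment-legal 0 (suc k) (λ _ ()) z≤n ≤-refl)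
    dominating : Dominating C s
    dominating w with segment-dominates k (map₂ (trans (c-toℕ zero)) h) (toℕ<n w)
    ... | y , y∈ , y▷w with ∈-map⁻ toℕ (subst (y ∈_) (sym s≡t) y∈)
    ...   | v , v∈s , refl = v , v∈s , ▷⇒InN y▷w

  c-last : c (suc k) ≡ C (fromℕ (suc k))
  c-last = trans (cong c (sym (toℕ-fromℕ (suc k)))) (c-toℕ _)

  both-ends⇒m₁≤ : C zero ≡ true → C (fromℕ (suc k)) ≡ true → m₁ C ≤ suc k
  both-ends⇒m₁≤ C0 Ce = ≤-trans (m₁≤ (≤δ₁ (s≤s (s≤s z≤n)) 2≤cardN)) (≤-reflexive (+-comm k 1))
    where
    c-end : c (suc (k + 0)) ≡ true
    c-end = subst (λ x → c (suc x) ≡ true) (sym (+-identityʳ k)) (trans c-last Ce)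
    2≤cardN : ∀ v → 2 ≤ cardN C v
    2≤cardN v with two-footprints (trans (c-toℕ zero) C0) c-end (Seg-toℕ v)
    ... | u₁ , u₂ , u₁≢u₂ , h₁ , h₂ =
      cardN-≥ ((u₁≢u₂ All.∷ All.[]) ∷ All.[] ∷ []) λ { (here refl) → h₁ ; (there (here refl)) → h₂ }

  cardN≤1 : ∀ {v} u₀ → (∀ {u} → Seg 0 (2 + k) u → toℕ v ▷ u → u ≡ u₀) → cardN C v ≤ 1
  cardN≤1 u₀ only = cardN-≤ {F = u₀ ∷ []} λ Su v▷u → here (only Su v▷u)

  missing-end⇒m₁≡ : (∀ v → C v ≡ false → ¬ Isolated v) → C zero ≡ false ⊎ C (fromℕ (suc k)) ≡ false
                  → m₁ C ≡ 2 + k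
  missing-end⇒m₁≡ no-isolated missing = ≤-antisym (m₁≤n no-isolated (s≤s z≤n)) (begin
    2 + k                 ≡⟨ +-comm 1 (suc k) ⟩
    2 + k ∸ 1 + 1         ≤⟨ +-monoˡ-≤ 1 (∸-monoʳ-≤ (2 + k) (δ₁≤1 missing)) ⟩
    m₁ C                  ∎)
    where
    open ≤-Reasoning
    δ₁≤1 : C zero ≡ false ⊎ C (fromℕ (suc k)) ≡ false → δ₁ C ≤ 1
    δ₁≤1 (inj₁ C0) = ≤-trans (δ₁≤cardN zero) (cardN≤1 1 λ
      { _ (inj₁ (c0 , _))    → ⊥-elim (false≢true (trans (sym C0) (trans (sym (c-toℕ zero)) c0)))
      ; _ (inj₂ (inj₁ refl)) → refl })
    δ₁≤1 (inj₂ Ce) = ≤-trans (δ₁≤cardN (fromℕ (suc k))) (cardN≤1 k only)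
      where
      only : ∀ {u} → Seg 0 (2 + k) u → toℕ (fromℕ (suc k)) ▷ u → u ≡ k
      only {u} Su e▷u with subst (_▷ u) (toℕ-fromℕ (suc k)) e▷u
      ... | inj₁ (ce , _)       = ⊥-elim (false≢true (trans (sym Ce) (trans (sym c-last) ce)))
      ... | inj₂ (inj₁ refl)    = ⊥-elim (<-irrefl refl (Seg₀⇒< Su))
      ... | inj₂ (inj₂ 1+u≡1+k) = suc-injective 1+u≡1+k

both-ends⇒GrundyIs : ∀ k (C : Fin (suc k) → Bool) → (∀ v → C v ≡ false → ¬ Isolated v)
                   → C zero ≡ true → C (fromℕ k) ≡ true → GrundyIs C (m₁ C)
both-ends⇒GrundyIs zero    C no-isolated C0 _ =
  Embedding.gconf⇒GrundyIs C no-isolated (s≤s z≤n) (subst (λ b → Gconf (b ∷ [])) (sym C0) gc1)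
both-ends⇒GrundyIs (suc k) C _ C0 Ce with prefix-sequence k C (inj₂ C0)
... | _ , ld , length≡1+k =
  Embedding.attains-m₁ C ld (≤-trans (both-ends⇒m₁≤ k C C0 Ce) (≤-reflexive (sym length≡1+k)))

GrundyIs-m₁∸1 : ∀ k (C : Fin (suc k) → Bool) → (∀ v → C v ≡ false → ¬ Isolated v)
              → ¬ ((C zero ≡ true × C (fromℕ k) ≡ true) ⊎ Gconf (pattern-of C)) → GrundyIs C (m₁ C ∸ 1)
GrundyIs-m₁∸1 zero C no-isolated ¬cond with C zero in C0
... | true  = ⊥-elim (¬cond (inj₁ (refl , refl)))
... | false = ⊥-elim (no-isolated zero C0 λ { zero → refl })
GrundyIs-m₁∸1 (suc zero) C _ ¬cond = ⊥-elim (¬cond (inj₂ (gc2 _ _ (¬cond ∘ inj₁))))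
GrundyIs-m₁∸1 (suc (suc k)) C no-isolated ¬cond =
  subst (GrundyIs C) (cong (_∸ 1) (sym m₁≡3+k)) (prefix-sequence (suc k) C (inj₁ (s≤s z≤n)) , shorter)
  where
  open Embedding C
  m₁≡3+k : m₁ C ≡ 3 + k
  m₁≡3+k = missing-end⇒m₁≡ (suc k) C no-isolated (not-both (¬cond ∘ inj₁))
  shorter : ∀ t → LegalDominating C t → length t ≤ 2 + k
  shorter t (t! , ℓ , _) with m≤n⇒m<n∨m≡n (subst (length t ≤_) m₁≡3+k (length≤m₁ t ℓ))
  ... | inj₁ t<3+k = ≤-pred t<3+k
  ... | inj₂ t≡3+k = ⊥-elim (¬cond (inj₂ (subst Gconf (sym pattern-of≡)
                      (full⇒gconf (2 + k) 0 _ (spanning⇒full no-isolated t ℓ t! (≤-reflexive (sym t≡3+k)))))))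

proposition3 : (k : ℕ) (C : Fin (suc k) → Bool)
    → (∀ v → C v ≡ false → ¬ Isolated v)
    → (((C zero ≡ true × C (fromℕ k) ≡ true) ⊎ Gconf (pattern-of C)) → GrundyIs C (m₁ C))
      × (¬ ((C zero ≡ true × C (fromℕ k) ≡ true) ⊎ Gconf (pattern-of C)) → GrundyIs C (m₁ C ∸ 1))
proposition3 k C no-isolated = attained , GrundyIs-m₁∸1 k C no-isolated
  where
  attained : (C zero ≡ true × C (fromℕ k) ≡ true) ⊎ Gconf (pattern-of C) → GrundyIs C (m₁ C)
  attained (inj₁ (C0 , Ce)) = both-ends⇒GrundyIs k C no-isolated C0 Ce
  attained (inj₂ gconf)     = Embedding.gconf⇒GrundyIs C no-isolated (s≤s z≤n) gconf
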